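{- Let $k,r,s\in\mathbb{N}$ and let $H$ be a minor of $S_{k,r,s}$. Then $S_{k,r,s}$ has a subgraph isomorphic to $H$.
   Context: All graphs are finite and simple. For $k,r,s\in\mathbb{N}$, $S_{k,r,s}$ is the graph whose vertex set is the disjoint union of sets $C,A_1,\dots,A_r$ with $|C|=k$ and $|A_i|=s$ for all $i$, in which $C$ and each $A_i$ induce cliques, every vertex of $C$ is adjacent to every other vertex of the graph, and there are no edges between $A_i$ and $A_j$ for $i\ne j$ (i.e. it is obtained from the star $K_{1,r}$ by replacing the centre by a $k$-clique and each leaf by an $s$-clique). A graph $H$ is a minor of $G$ if a graph isomorphic to $H$ can be obtained from a subgraph of $G$ by contracting edges (removing loops and parallel edges). -}

module Defs where

open import Data.Nat using (ℕ; _+_; _*_)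
open import Data.Fin using (Fin; splitAt; quotient; _≟_)
open import Data.Sum using (_⊎_; inj₁; inj₂)
open import Data.Product using (Σ; _×_; _,_; ∃; ∃-syntax; proj₁; proj₂)
open import Data.Maybe using (Maybe; just; nothing)
import Data.Maybe.Properties as MP
open import Relation.Binary.PropositionalEquality using (_≡_; _≢_; refl; sym)
open import Relation.Binary.Definitions using (Decidable)
open import Relation.Nullary using (¬_; Dec; yes; no)
open import Relation.Nullary.Decidable using (_×-dec_; _⊎-dec_; ¬?)
open import Function.Definitions using (Injective; Surjective)
open import Function.Bundles using (_⇔_)

record Graph : Set₁ where
  field
    n      : ℕ
    Adj    : Fin n → Fin n → Set
    symm   : ∀ {u v} → Adj u v → Adj v u
    irrefl : ∀ {v} → ¬ Adj v v
    dec    : Decidable Adj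
open Graph public

_≅_ : Graph → Graph → Set
H ≅ G = Σ (Fin (n H) → Fin (n G)) λ f → Σ (Fin (n G) → Fin (n H)) λ g →
          (∀ x → g (f x) ≡ x) × (∀ y → f (g y) ≡ y) ×
          (∀ x y → Adj H x y ⇔ Adj G (f x) (f y))

SubgraphOf : Graph → Graph → Set
SubgraphOf S G = Σ (Fin (n S) → Fin (n G)) λ f →
                   Injective _≡_ _≡_ f × (∀ x y → Adj S x y → Adj G (f x) (f y))

-- G' is (isomorphic to) the graph obtained from G by contracting one edge uv
-- and removing loops and parallel edges: φ is the quotient map of vertex sets
-- identifying exactly u and v.
ContractEdge : Graph → Graph → Set
ContractEdge G G' =
  Σ (Fin (n G)) λ u → Σ (Fin (n G)) λ v → Adj G u v ×
  Σ (Fin (n G) → Fin (n G')) λ φ →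
    Surjective _≡_ _≡_ φ ×
    (∀ x y → (φ x ≡ φ y) ⇔ (x ≡ y ⊎ (x ≡ u × y ≡ v) ⊎ (x ≡ v × y ≡ u))) ×
    (∀ a b → Adj G' a b ⇔ (a ≢ b × ∃[ x ] ∃[ y ] (φ x ≡ a × φ y ≡ b × Adj G x y)))

data Contracts : Graph → Graph → Set₁ where
  done : ∀ {G} → Contracts G G
  step : ∀ {G G₁ G₂} → ContractEdge G G₁ → Contracts G₁ G₂ → Contracts G G₂

MinorOf : Graph → Graph → Set₁
MinorOf H G = Σ Graph λ S → SubgraphOf S G × Σ Graph λ K → Contracts S K × (H ≅ K)

HasSubgraphIso : Graph → Graph → Set₁
HasSubgraphIso G H = Σ Graph λ S → SubgraphOf S G × (H ≅ S)

-- The graph S_{k,r,s} on Fin (k + r * s): the first k vertices form C;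
-- the remaining r * s vertices are split into r blocks A_i of size s
-- (via quotient s : Fin (r * s) → Fin r).
module _ (k r s : ℕ) where
  blockOf : Fin (k + r * s) → Maybe (Fin r)
  blockOf v with splitAt k v
  ... | inj₁ _ = nothing
  ... | inj₂ w = just (quotient s w)

  SAdj : Fin (k + r * s) → Fin (k + r * s) → Set
  SAdj u v = u ≢ v × (blockOf u ≡ nothing ⊎ blockOf v ≡ nothing ⊎ blockOf u ≡ blockOf v)

  private
    SAdj-sym : ∀ {u v} → SAdj u v → SAdj v u
    SAdj-sym (ne , inj₁ p) = (λ e → ne (sym e)) , inj₂ (inj₁ p)
    SAdj-sym (ne , inj₂ (inj₁ p)) = (λ e → ne (sym e)) , inj₁ p
    SAdj-sym (ne , inj₂ (inj₂ p)) = (λ e → ne (sym e)) , inj₂ (inj₂ (sym p))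

    SAdj-irr : ∀ {v} → ¬ SAdj v v
    SAdj-irr (ne , _) = ne refl

    SAdj-dec : Decidable SAdj
    SAdj-dec u v = ¬? (u ≟ v) ×-dec
      (MP.≡-dec _≟_ (blockOf u) nothing ⊎-dec
       (MP.≡-dec _≟_ (blockOf v) nothing ⊎-dec MP.≡-dec _≟_ (blockOf u) (blockOf v)))

  S : Graph
  S = record { n = k + r * s ; Adj = SAdj ; symm = SAdj-sym ; irrefl = SAdj-irr ; dec = SAdj-dec }

-- In S_{k,r,s} the closed neighbourhoods of the two ends of any edge are nested:
-- a vertex of C sees everything, and two vertices of the same A_i have the same
-- closed neighbourhood. In a host graph with this property, contracting an edge uv
-- of an embedded subgraph is undone by mapping the merged vertex to whichever of
-- u, v has the larger closed neighbourhood, so every minor is already a subgraph.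
module Submission where

open import Defs
open import Data.Nat using (ℕ)
open import Data.Fin using (Fin; _≟_)
open import Data.Maybe using (Maybe; nothing)
open import Data.Sum using (_⊎_; inj₁; inj₂)
open import Data.Product using (Σ; _×_; _,_; proj₁; proj₂)
open import Data.Empty using (⊥-elim)
open import Level using (0ℓ)
open import Function using (id; _∘_)
open import Function.Bundles using (Equivalence)
open import Relation.Unary using (Pred; _⊆_)
open import Relation.Nullary using (yes; no)
open import Relation.Binary.PropositionalEquality
  using (_≡_; _≢_; refl; sym; trans; cong; subst; module ≡-Reasoning)
open ≡-Reasoning

ClosedNbhd : (G : Graph) → Fin (n G) → Pred (Fin (n G)) 0ℓ
ClosedNbhd G u x = x ≡ u ⊎ Adj G u x

NestedEdges : Graph → Set
NestedEdges G = ∀ {u v} → Adj G u v →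
  ClosedNbhd G u ⊆ ClosedNbhd G v ⊎ ClosedNbhd G v ⊆ ClosedNbhd G u

⊆-ClosedNbhd⇒Adj : ∀ G {p p′ q} → ClosedNbhd G p ⊆ ClosedNbhd G p′ →
                   Adj G p q → p′ ≢ q → Adj G p′ q
⊆-ClosedNbhd⇒Adj G p⊆p′ pq p′≢q with p⊆p′ (inj₂ pq)
... | inj₁ q≡p′ = ⊥-elim (p′≢q (sym q≡p′))
... | inj₂ p′q  = p′q

contractEdge-preserves-SubgraphOf : ∀ T {G G′} → NestedEdges T →
                                   SubgraphOf G T → ContractEdge G G′ → SubgraphOf G′ T
contractEdge-preserves-SubgraphOf T {G} {G′} nested (f , f-inj , f-adj)
  (u , v , uv , φ , φ-surj , φ-identifies , G′-adj) = f ∘ section , f∘section-inj , f∘section-adj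
  where
  N[_] : Fin (n T) → Pred (Fin (n T)) 0ℓ
  N[_] = ClosedNbhd T

  φu≡φv : φ u ≡ φ v
  φu≡φv = Equivalence.from (φ-identifies u v) (inj₂ (inj₁ (refl , refl)))

  Merged : Fin (n G) → Set
  Merged x = x ≡ u ⊎ x ≡ v

  fibre : ∀ x y → φ x ≡ φ y → x ≡ y ⊎ Merged x
  fibre x y φx≡φy with Equivalence.to (φ-identifies x y) φx≡φy
  ... | inj₁ x≡y              = inj₁ x≡y
  ... | inj₂ (inj₁ (x≡u , _)) = inj₂ (inj₁ x≡u)
  ... | inj₂ (inj₂ (x≡v , _)) = inj₂ (inj₂ x≡v)

  φ≡φu⇒Merged : ∀ {x} → φ x ≡ φ u → Merged x
  φ≡φu⇒Merged {x} φx≡φu with fibre x u φx≡φu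
  ... | inj₁ x≡u = inj₁ x≡u
  ... | inj₂ m   = m

  Merged⇒φ≡φu : ∀ {x} → Merged x → φ x ≡ φ u
  Merged⇒φ≡φu (inj₁ refl) = refl
  Merged⇒φ≡φu (inj₂ refl) = sym φu≡φv

  dominant : Σ (Fin (n G)) λ w → Merged w × (∀ {x} → Merged x → N[ f x ] ⊆ N[ f w ])
  dominant with nested (f-adj u v uv)
  ... | inj₁ u⊆v = v , inj₂ refl , λ { (inj₁ refl) → u⊆v ; (inj₂ refl) → id }
  ... | inj₂ v⊆u = u , inj₁ refl , λ { (inj₁ refl) → id  ; (inj₂ refl) → v⊆u }

  section : Fin (n G′) → Fin (n G)
  section a with a ≟ φ u
  ... | yes _ = proj₁ dominant
  ... | no _  = proj₁ (φ-surj a)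

  section-inverse : ∀ a → φ (section a) ≡ a
  section-inverse a with a ≟ φ u
  ... | yes a≡φu = trans (Merged⇒φ≡φu (proj₁ (proj₂ dominant))) (sym a≡φu)
  ... | no _     = proj₂ (φ-surj a) refl

  f∘section-inj : ∀ {a b} → f (section a) ≡ f (section b) → a ≡ b
  f∘section-inj {a} {b} fsa≡fsb = begin
    a             ≡⟨ sym (section-inverse a) ⟩
    φ (section a) ≡⟨ cong φ (f-inj fsa≡fsb) ⟩
    φ (section b) ≡⟨ section-inverse b ⟩
    b             ∎

  section-dominates : ∀ x → N[ f x ] ⊆ N[ f (section (φ x)) ]
  section-dominates x with φ x ≟ φ u
  ... | yes φx≡φu = proj₂ (proj₂ dominant) (φ≡φu⇒Merged φx≡φu)
  ... | no φx≢φu with proj₂ (φ-surj (φ x)) refl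
  ...   | φx′≡φx with fibre _ x φx′≡φx
  ...     | inj₁ x′≡x      = subst (λ z → N[ f x ] ⊆ N[ f z ]) (sym x′≡x) id
  ...     | inj₂ x′-merged = ⊥-elim (φx≢φu (trans (sym φx′≡φx) (Merged⇒φ≡φu x′-merged)))

  section-apart : ∀ {a} y → a ≢ φ y → f (section a) ≢ f y
  section-apart {a} y a≢φy fsa≡fy = a≢φy (trans (sym (section-inverse a)) (cong φ (f-inj fsa≡fy)))

  f∘section-adj : ∀ a b → Adj G′ a b → Adj T (f (section a)) (f (section b))
  f∘section-adj a b ab with Equivalence.to (G′-adj a b) ab
  ... | a≢b , x , y , refl , refl , xy =
    symm T (⊆-ClosedNbhd⇒Adj T (section-dominates y) (symm T sx~y) λ e → a≢b (sym (f∘section-inj e)))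
    where
    sx~y : Adj T (f (section (φ x))) (f y)
    sx~y = ⊆-ClosedNbhd⇒Adj T (section-dominates x) (f-adj x y xy) (section-apart y a≢b)

contracts-preserve-SubgraphOf : ∀ T {G G′} → NestedEdges T →
                                Contracts G G′ → SubgraphOf G T → SubgraphOf G′ T
contracts-preserve-SubgraphOf T nested done                   sub = sub
contracts-preserve-SubgraphOf T nested (step {G} {G₁} ce ces) sub =
  contracts-preserve-SubgraphOf T nested ces (contractEdge-preserves-SubgraphOf T {G} {G₁} nested sub ce)

MinorOf⇒HasSubgraphIso : ∀ T {H} → NestedEdges T → MinorOf H T → HasSubgraphIso T H
MinorOf⇒HasSubgraphIso T nested (G , G⊆T , K , G↝K , H≅K) =
  K , contracts-preserve-SubgraphOf T nested G↝K G⊆T , H≅K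

module _ (k r s : ℕ) where

  private
    N[_] : Fin (n (S k r s)) → Pred (Fin (n (S k r s))) 0ℓ
    N[_] = ClosedNbhd (S k r s)

    β : Fin (n (S k r s)) → Maybe (Fin r)
    β = blockOf k r s

  S-universal-⊇ : ∀ {u} v → β u ≡ nothing → N[ v ] ⊆ N[ u ]
  S-universal-⊇ {u} v βu≡nothing {x} _ with x ≟ u
  ... | yes x≡u = inj₁ x≡u
  ... | no x≢u  = inj₂ ((λ u≡x → x≢u (sym u≡x)) , inj₁ βu≡nothing)

  S-sameBlock-⊆ : ∀ {u v} → β u ≡ β v → N[ u ] ⊆ N[ v ]
  S-sameBlock-⊆ {u} {v} βu≡βv {x} x∈N[u] with x ≟ v
  ... | yes x≡v = inj₁ x≡v
  ... | no x≢v  = inj₂ ((λ v≡x → x≢v (sym v≡x)) , compatible x∈N[u])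
    where
    compatible : x ≡ u ⊎ Adj (S k r s) u x →
                 β v ≡ nothing ⊎ β x ≡ nothing ⊎ β v ≡ β x
    compatible (inj₁ refl)     = inj₂ (inj₂ (sym βu≡βv))
    compatible (inj₂ (_ , ux)) = subst (λ m → m ≡ nothing ⊎ β x ≡ nothing ⊎ m ≡ β x) βu≡βv ux

  S-nestedEdges : NestedEdges (S k r s)
  S-nestedEdges {u} {v} (_ , inj₁ βu≡nothing)        = inj₂ (S-universal-⊇ v βu≡nothing)
  S-nestedEdges {u} {v} (_ , inj₂ (inj₁ βv≡nothing)) = inj₁ (S-universal-⊇ u βv≡nothing)
  S-nestedEdges {u} {v} (_ , inj₂ (inj₂ βu≡βv))      = inj₁ (S-sameBlock-⊆ βu≡βv)

lemma3p1 : (k r s : ℕ) (H : Graph) → MinorOf H (S k r s) → HasSubgraphIso (S k r s) H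
lemma3p1 k r s H = MinorOf⇒HasSubgraphIso (S k r s) {H} (S-nestedEdges k r s)
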